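{- Let $G$ be a finite graph with port numbering and binoculars labelling, and suppose Algorithm 1 (described in the context) halts on $G$ when started at $v_0\in V(G)$. Let $k$ and $H$ be the integer and graph computed by the algorithm before it halts, and let $\tilde v_0\in V(H)$ be any vertex with $v_0\sim_{2k}\tilde v_0$. Then for every vertex $\tilde u\in V(H)$ and any two paths $\tilde q,\tilde q'$ from $\tilde v_0$ to $\tilde u$ in $H$, $\mathrm{dest}_G(v_0,\lambda(\tilde q)) = \mathrm{dest}_G(v_0,\lambda(\tilde q'))$.
   Context: All graphs are simple, connected, undirected. A port numbering assigns to each vertex $v$ an injective map $\delta_v$ from the neighbours of $v$ to $\mathbb{N}$. Binoculars labelling: each vertex $v$ carries the label $\nu(v)$, the subgraph induced by the closed neighbourhood of $v$ with the port numbers of its edges (up to isomorphism preserving ports and the central vertex). A path is a sequence of vertices with consecutive vertices adjacent (repetitions allowed); a cycle is a path with equal endpoints; it is simple if it is empty or $(v_0,\dots,v_{k-1})$ has distinct vertices. For $p=(v_0,\dots,v_k)$, $\lambda(p)=(\delta_{v_0}(v_1),\dots,\delta_{v_{k-1}}(v_k))$; $\mathrm{dest}_G(v,s)$ is the vertex reached from $v$ in $G$ by successively following the ports of the sequence $s$. The view $\mathcal{V}_G(v)$ is the (possibly infinite) rooted tree: root labelled $\nu(v)$; for each neighbour $v_i$ of $v$ a child joined by an edge labelled $\delta_v(v_i)$ at the root end and $\delta_{v_i}(v)$ at the child end, the child being the root of a copy of $\mathcal{V}_G(v_i)$. $\mathcal{V}_G(v,k)$ is its truncation at depth $k$; $v\sim_k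 w$ iff the depth-$k$ truncated views of $v$ and $w$ (possibly in different graphs) are equal. Elementary homotopies of loops (sequences of vertices with consecutive vertices equal or adjacent, first = last) in the clique complex of $H$: insert/delete a subpath $(u,v,u)$; replace a subpath $q$ by $q'$ with same endpoints where $q^{ -1}q'$ is a triangle of $H$ ($q$ or $q'$ may be empty); delete one of two equal consecutive vertices. A loop is $k$-contractible if it can be reduced to a single vertex by a sequence of $k$ elementary homotopies. Algorithm 1 (the agent starts at $v_0$): set $k=0$; repeat: increment $k$; explore the ball of radius $2k$ around $v_0$ and compute $\mathcal{V}_G(v_0,2k)$; search for a finite graph $H$ with port numbering and binoculars labelling with $|V(H)|<k$ having a vertex $\tilde v_0$ with $\tilde v_0\sim_{2k} v_0$; until such an $H$ is found and every simple cycle of $H$ is $k$-contractible; then halt. -}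

module Defs where

open import Data.Nat using (ℕ; zero; suc; _<_; _≤_; _*_; _≡ᵇ_)
open import Data.Fin using (Fin)
open import Data.Bool using (Bool; true; false; _∧_)
open import Data.List using (List; []; _∷_; [_]; _++_; allFin; filterᵇ)
open import Data.Maybe using (Maybe; just; nothing)
open import Data.Product using (Σ; _×_; _,_; ∃)
open import Data.Sum using (_⊎_)
open import Relation.Nullary using (¬_)
open import Relation.Binary.PropositionalEquality using (_≡_)
open import Data.List.Relation.Unary.Unique.Propositional using (Unique)

data PathFT {A : Set} (R : A → A → Set) : List A → A → A → Set where
  single : (a : A) → PathFT R [ a ] a a
  cons   : {a b c : A} {xs : List A} → R a b →
           PathFT R (b ∷ xs) b c → PathFT R (a ∷ b ∷ xs) a c

-- Vertices are Fin n; adjacency is a symmetric irreflexive Boolean relation;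
-- port v x = δ_v(x), meaningful only when x is a neighbour of v, and
-- injective on neighbours.

record PGraph : Set where
  field
    n        : ℕ
    adj      : Fin n → Fin n → Bool
    port     : Fin n → Fin n → ℕ
    adj-sym  : ∀ u v → adj u v ≡ adj v u
    adj-irr  : ∀ v → adj v v ≡ false
    port-inj : ∀ v x y → adj v x ≡ true → adj v y ≡ true →
               port v x ≡ port v y → x ≡ y
    connected : ∀ u v → Σ (List (Fin n)) λ p → PathFT (λ a b → adj a b ≡ true) p u v

open PGraph public

V : PGraph → Set
V G = Fin (n G)

Adj : (G : PGraph) → V G → V G → Set
Adj G u v = adj G u v ≡ true

Path : (G : PGraph) → List (V G) → V G → V G → Set
Path G = PathFT (Adj G)

-- Binoculars labels: ν(v) ≅ ν(w) iff there is an isomorphism of the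
-- subgraphs induced by the closed neighbourhoods N[v], N[w], sending v to w
-- and preserving the port numbers of all edges of the induced subgraph.

InN : (G : PGraph) → V G → V G → Set
InN G v x = x ≡ v ⊎ Adj G v x

LabelEq : (G : PGraph) → V G → (H : PGraph) → V H → Set
LabelEq G v H w =
  Σ (V G → V H) λ f →
      f v ≡ w
    × (∀ x → InN G v x → InN H w (f x))
    × (∀ x y → InN G v x → InN G v y → f x ≡ f y → x ≡ y)
    × (∀ y → InN H w y → Σ (V G) λ x → InN G v x × f x ≡ y)
    × (∀ x y → InN G v x → InN G v y → adj G x y ≡ adj H (f x) (f y))
    × (∀ x y → InN G v x → InN G v y → Adj G x y →
         port G x y ≡ port H (f x) (f y))

-- v ∼ₖ w : equality of the depth-k truncated views.  Two truncated views
-- are equal iff the root labels are equal and the children correspond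
-- (children are determined by the port at the root end) with equal edge
-- labels (both ends) and equal depth-(k-1) subtrees.

Sim : ℕ → (G : PGraph) → V G → (H : PGraph) → V H → Set
Sim zero    G v H w = LabelEq G v H w
Sim (suc k) G v H w =
    LabelEq G v H w
  × (∀ x → Adj G v x → Σ (V H) λ y → Adj H w y
        × port G v x ≡ port H w y × port G x v ≡ port H y w × Sim k G x H y)
  × (∀ y → Adj H w y → Σ (V G) λ x → Adj G v x
        × port G v x ≡ port H w y × port G x v ≡ port H y w × Sim k G x H y)

labels : (G : PGraph) → List (V G) → List ℕ
labels G []           = []
labels G (x ∷ [])     = []
labels G (x ∷ y ∷ ys) = port G x y ∷ labels G (y ∷ ys)

follow : (G : PGraph) → V G → ℕ → Maybe (V G)
follow G x p with filterᵇ (λ y → adj G x y ∧ (port G x y ≡ᵇ p)) (allFin (n G))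
... | []    = nothing
... | y ∷ _ = just y

dest : (G : PGraph) → V G → List ℕ → Maybe (V G)
dest G v []       = just v
dest G v (p ∷ s) with follow G v p
... | nothing = nothing
... | just v' = dest G v' s

Cycle : (G : PGraph) → List (V G) → Set
Cycle G c = Σ (V G) λ a → Path G c a a

SimpleCycle : (G : PGraph) → List (V G) → Set
SimpleCycle G c = Σ (V G) λ a → Path G c a a
  × Σ (List (V G)) λ vs → c ≡ vs ++ [ a ] × Unique vs

EqOrAdj : (H : PGraph) → V H → V H → Set
EqOrAdj H u v = u ≡ v ⊎ Adj H u v

Triangle : (H : PGraph) → V H → V H → V H → Set
Triangle H a b c = Adj H a b × Adj H b c × Adj H a c

data Rule (H : PGraph) : List (V H) → List (V H) → Set where
  spike-ins  : ∀ u v → EqOrAdj H u v → Rule H (u ∷ []) (u ∷ v ∷ u ∷ [])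
  spike-del  : ∀ u v → EqOrAdj H u v → Rule H (u ∷ v ∷ u ∷ []) (u ∷ [])
  tri-12     : ∀ a b c → Triangle H a b c → Rule H (a ∷ c ∷ []) (a ∷ b ∷ c ∷ [])
  tri-21     : ∀ a b c → Triangle H a b c → Rule H (a ∷ b ∷ c ∷ []) (a ∷ c ∷ [])
  tri-03     : ∀ a b c → Triangle H a b c → Rule H (a ∷ []) (a ∷ b ∷ c ∷ a ∷ [])
  tri-30     : ∀ a b c → Triangle H a b c → Rule H (a ∷ b ∷ c ∷ a ∷ []) (a ∷ [])
  dup-del    : ∀ u → Rule H (u ∷ u ∷ []) (u ∷ [])

data Step (H : PGraph) : List (V H) → List (V H) → Set where
  step : ∀ pre post {q q'} → Rule H q q' →
         Step H (pre ++ q ++ post) (pre ++ q' ++ post)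

data Reduces (H : PGraph) : ℕ → List (V H) → List (V H) → Set where
  done : ∀ {k l} → Reduces H k l l
  more : ∀ {k l l' l''} → Step H l l' → Reduces H k l' l'' →
         Reduces H (suc k) l l''

Contractible : (H : PGraph) → ℕ → List (V H) → Set
Contractible H k c = Σ (V H) λ x → Reduces H k c [ x ]

Found : (G : PGraph) → V G → ℕ → PGraph → Set
Found G v₀ k H = n H < k × Σ (V H) λ w → Sim (2 * k) G v₀ H w

AllSimpleCyclesContractible : ℕ → PGraph → Set
AllSimpleCyclesContractible k H =
  ∀ c → SimpleCycle H c → Contractible H k c

-- Some run of Algorithm 1 from v₀ on G halts at iteration k with graph H:
-- the halting test succeeds at k with H, and at every earlier iteration
-- k' either no admissible graph exists or the graph found fails the test.
HaltsWith : (G : PGraph) → V G → ℕ → PGraph → Set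
HaltsWith G v₀ k H =
    1 ≤ k
  × Found G v₀ k H
  × AllSimpleCyclesContractible k H
  × (∀ k' → 1 ≤ k' → k' < k →
       (∀ H' → ¬ Found G v₀ k' H')
     ⊎ Σ PGraph λ H' → Found G v₀ k' H' × ¬ AllSimpleCyclesContractible k' H')

-- Walks of H are copied into G port by port, keeping track of the depth up to which copied
-- vertices have equal views.  Since the binoculars label of a vertex determines the triangles
-- through it, every elementary homotopy of a loop can be mirrored in G at the cost of one level
-- of depth, so a k-contractible loop lifts to a closed walk from any vertex k-similar to its base.
-- A closed walk at ṽ₀ consists of a repetition-free prefix (shorter than |V(H)| < k), a simple
-- cycle, and a shorter closed walk; by induction on length it lifts to a closed walk at v₀.

module Submission where

open import Defs
open import Data.Nat using (ℕ; zero; suc; _*_; _+_; _≤_; _<_; z≤n; s≤s; _≡ᵇ_)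
open import Data.Nat.Properties
  using (≤-trans; ≤-reflexive; n≤1+n; m≤n+m; m≤m+n; +-suc; +-identityʳ; +-monoˡ-≤; +-mono-≤; <⇒≤; ≡ᵇ⇒≡; ≡⇒≡ᵇ)
open import Data.Nat.Induction using (<-wellFounded)
open import Data.Bool using (Bool; _∧_; T)
open import Data.Bool.Properties using (T-∧; T-≡)
open import Data.Fin using (Fin)
open import Data.Fin.Properties using (injective⇒≤)
open import Data.List using (List; []; _∷_; [_]; _++_; length; lookup; head; filterᵇ; allFin)
open import Data.List.Properties using (++-assoc; ++-identityʳ; length-++-≤ʳ)
open import Data.List.Membership.Propositional using (_∈_)
open import Data.List.Membership.Propositional.Properties using (∈-allFin; ∈-filter⁺; ∈-lookup; ∈-∃++; ∈-++⁺ʳ)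
open import Data.List.Relation.Unary.All as All using (All; _∷_)
open import Data.List.Relation.Unary.All.Properties using (all-filter)
open import Data.List.Relation.Unary.AllPairs as AllPairs using (_∷_)
open import Data.List.Relation.Unary.Any using (here)
open import Data.List.Relation.Unary.Unique.Propositional using (Unique)
open import Data.List.Relation.Unary.Unique.Propositional.Properties using (++⁺; Unique[x∷xs]⇒x∉xs)
import Data.List.Membership.DecPropositional as DecMembership
open import Data.Maybe using (just)
open import Data.Product using (_×_; _,_; proj₁; proj₂; map₂; ∃-syntax)
open import Data.Sum using (_⊎_; inj₁; inj₂)
open import Data.Empty using (⊥-elim)
open import Function using (_∘_; _on_; Equivalence)
open import Induction.WellFounded using (Acc; acc)
open import Relation.Binary.Construct.On using () renaming (wellFounded to on-wellFounded)
open import Relation.Binary.Definitions using (DecidableEquality)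
open import Relation.Nullary using (yes; no; contradiction)
open import Relation.Nullary.Decidable using (T?)
open import Relation.Binary.PropositionalEquality using (_≡_; _≢_; refl; sym; trans; cong; subst; module ≡-Reasoning)

module _ {A : Set} where

  Unique-lookup-injective : ∀ {xs : List A} → Unique xs → ∀ i j → lookup xs i ≡ lookup xs j → i ≡ j
  Unique-lookup-injective (_ ∷ _) Fin.zero Fin.zero _ = refl
  Unique-lookup-injective (x∉ ∷ _) Fin.zero (Fin.suc j) eq = contradiction eq (All.lookup x∉ (∈-lookup j))
  Unique-lookup-injective (x∉ ∷ _) (Fin.suc i) Fin.zero eq = contradiction (sym eq) (All.lookup x∉ (∈-lookup i))
  Unique-lookup-injective (_ ∷ u) (Fin.suc i) (Fin.suc j) eq = cong Fin.suc (Unique-lookup-injective u i j eq)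

  Unique-++⁻ʳ : ∀ (xs : List A) {ys} → Unique (xs ++ ys) → Unique ys
  Unique-++⁻ʳ []       u       = u
  Unique-++⁻ʳ (_ ∷ xs) (_ ∷ u) = Unique-++⁻ʳ xs u

  length-++-∷-≤ : ∀ (xs : List A) x ys → length (xs ++ [ x ]) ≤ length (xs ++ x ∷ ys)
  length-++-∷-≤ []       _ _  = s≤s z≤n
  length-++-∷-≤ (_ ∷ xs) x ys = s≤s (length-++-∷-≤ xs x ys)

  length-cut-loop : ∀ (xs : List A) x ys zs → length (xs ++ x ∷ zs) < length (xs ++ x ∷ ys ++ x ∷ zs)
  length-cut-loop [] x ys zs = s≤s (length-++-≤ʳ (x ∷ zs) {ys})
  length-cut-loop (_ ∷ xs) x ys zs = s≤s (length-cut-loop xs x ys zs)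

Unique⇒length≤ : ∀ {m} {xs : List (Fin m)} → Unique xs → length xs ≤ m
Unique⇒length≤ u = injective⇒≤ (Unique-lookup-injective u _ _)

Repetition : {A : Set} → List A → Set
Repetition xs = ∃[ pre ] ∃[ x ] ∃[ mid ] ∃[ post ] xs ≡ pre ++ x ∷ mid ++ x ∷ post × Unique (pre ++ x ∷ mid)

module _ {A : Set} (_≟_ : DecidableEquality A) where

  private
    first-repetition-after : ∀ seen rest → Unique seen → Unique (seen ++ rest) ⊎ Repetition (seen ++ rest)
    first-repetition-after seen [] u = inj₁ (subst Unique (sym (++-identityʳ seen)) u)
    first-repetition-after seen (y ∷ rest) u with DecMembership._∈?_ _≟_ y seen
    ... | yes y∈seen with ∈-∃++ y∈seen
    ...   | pre , mid , refl = inj₂ (pre , y , mid , rest , ++-assoc pre (y ∷ mid) (y ∷ rest) , u)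
    first-repetition-after seen (y ∷ rest) u | no y∉seen =
      subst (λ xs → Unique xs ⊎ Repetition xs) (++-assoc seen [ y ] rest)
        (first-repetition-after (seen ++ [ y ]) rest (++⁺ u (All.[] ∷ AllPairs.[]) λ { (y∈seen , here refl) → y∉seen y∈seen }))

  Unique⊎Repetition : ∀ xs → Unique xs ⊎ Repetition xs
  Unique⊎Repetition xs = first-repetition-after [] xs AllPairs.[]

module _ {A : Set} {R : A → A → Set} where

  PathFT-head : ∀ {x xs a b} → PathFT R (x ∷ xs) a b → x ≡ a
  PathFT-head (single _) = refl
  PathFT-head (cons _ _) = refl

  PathFT-last : ∀ {xs a b} → PathFT R xs a b → ∃[ vs ] xs ≡ vs ++ [ b ]
  PathFT-last (single _) = [] , refl
  PathFT-last (cons {a = a} _ p) with PathFT-last p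
  ... | vs , eq = a ∷ vs , cong (a ∷_) eq

  PathFT-split : ∀ (P : List A) {x Q a b} → PathFT R (P ++ x ∷ Q) a b →
                 PathFT R (P ++ [ x ]) a x × PathFT R (x ∷ Q) x b
  PathFT-split [] p with PathFT-head p
  ... | refl = single _ , p
  PathFT-split (_ ∷ []) (cons r p) = cons r (single _) , p
  PathFT-split (_ ∷ y ∷ P) (cons r p) with PathFT-split (y ∷ P) p
  ... | p₁ , p₂ = cons r p₁ , p₂

  PathFT-join : ∀ (P : List A) {x Q a b c} → PathFT R (P ++ [ x ]) a c → PathFT R (x ∷ Q) c b →
                PathFT R (P ++ x ∷ Q) a b
  PathFT-join [] (single _) q = q
  PathFT-join (_ ∷ []) (cons r (single _)) q = cons r q
  PathFT-join (_ ∷ y ∷ P) (cons r p) q = cons r (PathFT-join (y ∷ P) p q)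

  PathFT-unique-loop : ∀ {xs a} → Unique xs → PathFT R xs a a → xs ≡ [ a ]
  PathFT-unique-loop _ (single _) = refl
  PathFT-unique-loop u (cons _ p) with PathFT-last p
  ... | vs , eq = contradiction (subst (_ ∈_) (sym eq) (∈-++⁺ʳ vs (here refl))) (Unique[x∷xs]⇒x∉xs u)

Adj-sym : (G : PGraph) {u v : V G} → Adj G u v → Adj G v u
Adj-sym G {u} {v} uv = trans (adj-sym G v u) uv

Adj-irrefl : (G : PGraph) {u v : V G} → Adj G u v → u ≢ v
Adj-irrefl G {u} uv refl with trans (sym uv) (adj-irr G u)
... | ()

head-filterᵇ-unique : {A : Set} (P : A → Bool) {w : A} {xs : List A} → w ∈ xs → T (P w) →
                      (∀ y → T (P y) → y ≡ w) → head (filterᵇ P xs) ≡ just w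
head-filterᵇ-unique P {w} {xs} w∈xs Pw only-w with filterᵇ P xs in eq
... | [] with subst (w ∈_) eq (∈-filter⁺ (T? ∘ P) w∈xs Pw)
...   | ()
head-filterᵇ-unique P {w} {xs} w∈xs Pw only-w | y ∷ _ with subst (All (T ∘ P)) eq (all-filter (T? ∘ P) xs)
...   | Py ∷ _ = cong just (only-w y Py)

follow-head : (G : PGraph) (u : V G) (p : ℕ) →
              follow G u p ≡ head (filterᵇ (λ y → adj G u y ∧ (port G u y ≡ᵇ p)) (allFin (n G)))
follow-head G u p with filterᵇ (λ y → adj G u y ∧ (port G u y ≡ᵇ p)) (allFin (n G))
... | []    = refl
... | _ ∷ _ = refl

follow-port : (G : PGraph) {u w : V G} → Adj G u w → follow G u (port G u w) ≡ just w
follow-port G {u} {w} uw = trans (follow-head G u (port G u w))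
  (head-filterᵇ-unique _ (∈-allFin w) (Equivalence.from T-∧ (Equivalence.from T-≡ uw , ≡⇒≡ᵇ (port G u w) _ refl)) only-w)
  where
  only-w : ∀ y → T (adj G u y ∧ (port G u y ≡ᵇ port G u w)) → y ≡ w
  only-w y t with Equivalence.to T-∧ t
  ... | uy , same-port = port-inj G u y w (Equivalence.to T-≡ uy) uw (≡ᵇ⇒≡ _ _ same-port)

dest-port : (G : PGraph) {u w : V G} (s : List ℕ) → Adj G u w → dest G u (port G u w ∷ s) ≡ dest G w s
dest-port G s uw rewrite follow-port G uw = refl

module _ {G H : PGraph} where

  Sim⇒LabelEq : ∀ d {w x} → Sim d G w H x → LabelEq G w H x
  Sim⇒LabelEq zero    s = s
  Sim⇒LabelEq (suc d) s = proj₁ s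

  Sim-weaken : ∀ {e d w x} → e ≤ d → Sim d G w H x → Sim e G w H x
  Sim-weaken {d = d}  z≤n       s                   = Sim⇒LabelEq d s
  Sim-weaken {suc e} (s≤s e≤d) (ℓ , forth , back) =
    ℓ , (λ x wx → map₂ (map₂ (map₂ (map₂ (Sim-weaken e≤d)))) (forth x wx))
      , (λ y ay → map₂ (map₂ (map₂ (map₂ (Sim-weaken e≤d)))) (back y ay))

module _ (G H : PGraph) where

  EdgeMatch : V G → V H → V G → V H → Set
  EdgeMatch w a x b = Adj G w x × port G w x ≡ port H a b × port G x w ≡ port H b a

  EdgeMatch-sym : ∀ {w a x b} → EdgeMatch w a x b → EdgeMatch x b w a
  EdgeMatch-sym (wx , p , p′) = Adj-sym G wx , p′ , p

  EdgeMatch-target-unique : ∀ {w a x x′ b} → EdgeMatch w a x b → EdgeMatch w a x′ b → x ≡ x′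
  EdgeMatch-target-unique {w} (wx , p , _) (wx′ , p′ , _) = port-inj G w _ _ wx wx′ (trans p (sym p′))

  EdgeMatch-source-unique : ∀ {w w′ a x b} → EdgeMatch w a x b → EdgeMatch w′ a x b → w ≡ w′
  EdgeMatch-source-unique m m′ = EdgeMatch-target-unique (EdgeMatch-sym m) (EdgeMatch-sym m′)

  Sim-pred : ∀ {e w a} → Sim (suc e) G w H a → Sim e G w H a
  Sim-pred {e} = Sim-weaken (n≤1+n e)

  Sim-neighbour : ∀ {e w a b} → Sim (suc e) G w H a → Adj H a b → ∃[ x ] EdgeMatch w a x b × Sim e G x H b
  Sim-neighbour (_ , _ , back) ab with back _ ab
  ... | x , wx , p , p′ , s = x , (wx , p , p′) , s

  module _ {w : V G} {a : V H} (ℓ : LabelEq G w H a) where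

    private
      f = proj₁ ℓ
      f-centre = proj₁ (proj₂ ℓ)
      f-inN = proj₁ (proj₂ (proj₂ ℓ))
      f-inj = proj₁ (proj₂ (proj₂ (proj₂ ℓ)))
      f-surj = proj₁ (proj₂ (proj₂ (proj₂ (proj₂ ℓ))))
      f-adj = proj₁ (proj₂ (proj₂ (proj₂ (proj₂ (proj₂ ℓ)))))
      f-port = proj₂ (proj₂ (proj₂ (proj₂ (proj₂ (proj₂ ℓ)))))

    LabelEq-edge : ∀ {x y b c} → InN G w x → InN G w y → f x ≡ b → f y ≡ c → Adj H b c → EdgeMatch x b y c
    LabelEq-edge {x} {y} x∈N y∈N refl refl bc = xy , f-port x y x∈N y∈N xy , f-port y x y∈N x∈N (Adj-sym G xy)
      where
      xy : Adj G x y
      xy = trans (f-adj x y x∈N y∈N) bc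

    LabelEq-neighbour : ∀ {x b} → Adj H a b → EdgeMatch w a x b → f x ≡ b
    LabelEq-neighbour {x} {b} ab (wx , p , _) with f-inN x (inj₂ wx)
    ... | inj₁ fx≡a = ⊥-elim (Adj-irrefl G wx (sym (f-inj x w (inj₂ wx) (inj₁ refl) (trans fx≡a (sym f-centre)))))
    ... | inj₂ a-fx = port-inj H a (f x) b a-fx ab (trans (sym p-fx) p)
      where
      p-fx : port G w x ≡ port H a (f x)
      p-fx = subst (λ c → port G w x ≡ port H c (f x)) f-centre (f-port w x (inj₁ refl) (inj₂ wx) wx)

    triangle-fill : ∀ {b c x y} → Triangle H a b c → EdgeMatch w a x b → EdgeMatch w a y c → EdgeMatch x b y c
    triangle-fill (ab , bc , ac) wx wy =
      LabelEq-edge (inj₂ (proj₁ wx)) (inj₂ (proj₁ wy)) (LabelEq-neighbour ab wx) (LabelEq-neighbour ac wy) bc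

    triangle-close : ∀ {b c x y} → Triangle H a b c → EdgeMatch w a x b → EdgeMatch x b y c → EdgeMatch w a y c
    triangle-close (ab , bc , ac) wx xy with f-surj _ (inj₂ ac)
    ... | z , z∈N , fz≡c with EdgeMatch-target-unique (LabelEq-edge (inj₂ (proj₁ wx)) z∈N (LabelEq-neighbour ab wx) fz≡c bc) xy
    ... | refl = LabelEq-edge (inj₁ refl) z∈N f-centre fz≡c ac

  data Follows (w : V G) (a : V H) : V G → V H → Set where
    stay : Follows w a w a
    move : ∀ {x b} → Adj H a b → EdgeMatch w a x b → Follows w a x b

  Follows-sym : ∀ {w a x b} → Follows w a x b → Follows x b w a
  Follows-sym stay          = stay
  Follows-sym (move ab wx) = move (Adj-sym H ab) (EdgeMatch-sym wx)

  Follows⇒EdgeMatch : ∀ {w a x b} → Adj H a b → Follows w a x b → EdgeMatch w a x b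
  Follows⇒EdgeMatch ab stay        = ⊥-elim (Adj-irrefl H ab refl)
  Follows⇒EdgeMatch _  (move _ wx) = wx

  Follows-return : ∀ {w a x b y} → Follows w a x b → Follows x b y a → y ≡ w
  Follows-return stay         stay          = refl
  Follows-return stay         (move aa _)   = ⊥-elim (Adj-irrefl H aa refl)
  Follows-return (move aa _)  stay          = ⊥-elim (Adj-irrefl H aa refl)
  Follows-return (move _ wx)  (move _ xy)   = EdgeMatch-target-unique xy (EdgeMatch-sym wx)

  Sim-follows : ∀ {e w a b} → Sim (suc e) G w H a → EqOrAdj H a b → ∃[ x ] Follows w a x b × Sim e G x H b
  Sim-follows s (inj₁ refl) = _ , stay , Sim-pred s
  Sim-follows s (inj₂ ab) with Sim-neighbour s ab
  ... | x , wx , s′ = x , move ab wx , s′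

  -- A walk of G from w to z copying L step by step (a repeated vertex of L by a repeated
  -- vertex, an edge by an edge with the same ports), each vertex e-similar to its model.
  data Lifting (e : ℕ) : V G → List (V H) → V G → Set where
    stop    : ∀ {w a} → Sim e G w H a → Lifting e w [ a ] w
    _∷⟨_⟩_ : ∀ {w a x b L z} → Sim e G w H a → Follows w a x b → Lifting e x (b ∷ L) z →
              Lifting e w (a ∷ b ∷ L) z

  Lifting-head : ∀ {e w a L z} → Lifting e w (a ∷ L) z → Sim e G w H a
  Lifting-head (stop s)     = s
  Lifting-head (s ∷⟨ _ ⟩ _) = s

  Lifting-weaken : ∀ {e d w L z} → e ≤ d → Lifting d w L z → Lifting e w L z
  Lifting-weaken e≤d (stop s)      = stop (Sim-weaken e≤d s)
  Lifting-weaken e≤d (s ∷⟨ f ⟩ l) = Sim-weaken e≤d s ∷⟨ f ⟩ Lifting-weaken e≤d l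

  Lifting-pred : ∀ {e w L z} → Lifting (suc e) w L z → Lifting e w L z
  Lifting-pred {e} = Lifting-weaken (n≤1+n e)

  Lifting-split : ∀ (P : List (V H)) {e a Q w z} → Lifting e w (P ++ a ∷ Q) z →
                  ∃[ y ] Lifting e w (P ++ [ a ]) y × Lifting e y (a ∷ Q) z
  Lifting-split []          l              = _ , stop (Lifting-head l) , l
  Lifting-split (_ ∷ [])    (s ∷⟨ f ⟩ l) = _ , s ∷⟨ f ⟩ stop (Lifting-head l) , l
  Lifting-split (_ ∷ b ∷ P) (s ∷⟨ f ⟩ l) with Lifting-split (b ∷ P) l
  ... | y , l₁ , l₂ = y , s ∷⟨ f ⟩ l₁ , l₂

  Lifting-join : ∀ (P : List (V H)) {e a Q w y z} → Lifting e w (P ++ [ a ]) y → Lifting e y (a ∷ Q) z →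
                 Lifting e w (P ++ a ∷ Q) z
  Lifting-join []          (stop _)                 l = l
  Lifting-join (_ ∷ [])    (s ∷⟨ f ⟩ stop _)       l = s ∷⟨ f ⟩ l
  Lifting-join (_ ∷ b ∷ P) (s ∷⟨ f ⟩ l₁)            l = s ∷⟨ f ⟩ Lifting-join (b ∷ P) l₁ l

  Rule-lift : ∀ {e q q′ post w z} → Rule H q q′ → Lifting (suc e) w (q′ ++ post) z → Lifting e w (q ++ post) z
  Rule-lift (spike-ins _ _ _) (_ ∷⟨ f₁ ⟩ (_ ∷⟨ f₂ ⟩ l)) with Follows-return f₁ f₂
  ... | refl = Lifting-pred l
  Rule-lift (spike-del _ _ ab) l with Sim-follows (Lifting-head l) ab
  ... | _ , f , s = Sim-pred (Lifting-head l) ∷⟨ f ⟩ (s ∷⟨ Follows-sym f ⟩ Lifting-pred l)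
  Rule-lift (tri-12 _ _ _ t@(ab , bc , ac)) (s ∷⟨ f₁ ⟩ (_ ∷⟨ f₂ ⟩ l)) =
    Sim-pred s
      ∷⟨ move ac (triangle-close (Sim⇒LabelEq (suc _) s) t (Follows⇒EdgeMatch ab f₁) (Follows⇒EdgeMatch bc f₂)) ⟩
    Lifting-pred l
  Rule-lift (tri-21 _ _ _ t@(ab , bc , ac)) (s ∷⟨ f ⟩ l) with Sim-neighbour s ab
  ... | x , wx , sx =
    Sim-pred s ∷⟨ move ab wx ⟩
      (sx ∷⟨ move bc (triangle-fill (Sim⇒LabelEq (suc _) s) t wx (Follows⇒EdgeMatch ac f)) ⟩ Lifting-pred l)
  Rule-lift (tri-03 _ _ _ t@(ab , bc , ac)) (s ∷⟨ f₁ ⟩ (_ ∷⟨ f₂ ⟩ (_ ∷⟨ f₃ ⟩ l)))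
    with Follows-return (move ac (triangle-close (Sim⇒LabelEq (suc _) s) t (Follows⇒EdgeMatch ab f₁) (Follows⇒EdgeMatch bc f₂))) f₃
  ... | refl = Lifting-pred l
  Rule-lift (tri-30 _ _ _ t@(ab , bc , ac)) l with Sim-neighbour (Lifting-head l) ab | Sim-neighbour (Lifting-head l) ac
  ... | x , wx , sx | y , wy , sy =
    Sim-pred (Lifting-head l) ∷⟨ move ab wx ⟩
      (sx ∷⟨ move bc (triangle-fill (Sim⇒LabelEq (suc _) (Lifting-head l)) t wx wy) ⟩
        (sy ∷⟨ move (Adj-sym H ac) (EdgeMatch-sym wy) ⟩ Lifting-pred l))
  Rule-lift (dup-del _) l = Sim-pred (Lifting-head l) ∷⟨ stay ⟩ Lifting-pred l

  Rule-head : ∀ {q q′} → Rule H q q′ → ∃[ a ] ∃[ X ] ∃[ Y ] q ≡ a ∷ X × q′ ≡ a ∷ Y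
  Rule-head (spike-ins _ _ _) = _ , _ , _ , refl , refl
  Rule-head (spike-del _ _ _) = _ , _ , _ , refl , refl
  Rule-head (tri-12 _ _ _ _)  = _ , _ , _ , refl , refl
  Rule-head (tri-21 _ _ _ _)  = _ , _ , _ , refl , refl
  Rule-head (tri-03 _ _ _ _)  = _ , _ , _ , refl , refl
  Rule-head (tri-30 _ _ _ _)  = _ , _ , _ , refl , refl
  Rule-head (dup-del _)       = _ , _ , _ , refl , refl

  Step-head : ∀ {l l′} → Step H l l′ → head l ≡ head l′
  Step-head (step [] _ r) with Rule-head r
  ... | _ , _ , _ , refl , refl = refl
  Step-head (step (_ ∷ _) _ _) = refl

  Reduces-head : ∀ {s l l′} → Reduces H s l l′ → head l ≡ head l′
  Reduces-head done         = refl
  Reduces-head (more st rs) = trans (Step-head st) (Reduces-head rs)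

  Step-lift : ∀ {e l l′ w z} → Step H l l′ → Lifting (suc e) w l′ z → Lifting e w l z
  Step-lift (step pre post r) l with Rule-head r
  ... | _ , _ , _ , refl , refl with Lifting-split pre l
  ... | _ , l₁ , l₂ = Lifting-join pre (Lifting-pred l₁) (Rule-lift r l₂)

  Reduces-lift : ∀ {s e l l′ w z} → Reduces H s l l′ → Lifting (s + e) w l′ z → Lifting e w l z
  Reduces-lift {s} {e} done l = Lifting-weaken (m≤n+m e s) l
  Reduces-lift {suc s} {e} (more st rs) l = Step-lift st (Reduces-lift rs (Lifting-weaken (≤-reflexive (+-suc s e)) l))

  Contractible-lift : ∀ {k c a w} → Contractible H k c → Path H c a a → Sim k G w H a → Lifting 0 w c w
  Contractible-lift {k} {[]} _ () _
  Contractible-lift {k} {_ ∷ _} (x , rs) p s with PathFT-head p | Reduces-head rs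
  ... | refl | refl = Reduces-lift rs (stop (Sim-weaken (≤-reflexive (+-identityʳ k)) s))

  Path-lift : ∀ {e L a b w} → Path H L a b → Sim (length L + e) G w H a → ∃[ z ] Lifting e w L z × Sim e G z H b
  Path-lift {e} (single _) s = _ , stop (Sim-weaken (m≤n+m e 1) s) , Sim-weaken (m≤n+m e 1) s
  Path-lift {e} {_ ∷ L} (cons ab p) s with Sim-neighbour {length L + e} s ab
  ... | x , wx , sx with Path-lift {e} p sx
  ... | z , l , sz = z , Sim-weaken (m≤n+m e (suc (length L))) s ∷⟨ move ab wx ⟩ l , sz

  Lifting-end-unique : ∀ {e e′ w L z z′ a b} → Path H L a b → Lifting e w L z → Lifting e′ w L z′ → z ≡ z′
  Lifting-end-unique (single _)  (stop _)       (stop _)        = refl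
  Lifting-end-unique (cons ab p) (_ ∷⟨ f ⟩ l) (_ ∷⟨ f′ ⟩ l′)
    with EdgeMatch-target-unique (Follows⇒EdgeMatch ab f) (Follows⇒EdgeMatch ab f′)
  ... | refl = Lifting-end-unique p l l′

  Lifting-start-unique : ∀ {e e′ w w′ L z a b} → Path H L a b → Lifting e w L z → Lifting e′ w′ L z → w ≡ w′
  Lifting-start-unique (single _)  (stop _)       (stop _)        = refl
  Lifting-start-unique (cons ab p) (_ ∷⟨ f ⟩ l) (_ ∷⟨ f′ ⟩ l′)
    with Lifting-start-unique p l l′
  ... | refl = EdgeMatch-source-unique (Follows⇒EdgeMatch ab f) (Follows⇒EdgeMatch ab f′)

  Lifting-dest : ∀ {e w L z a b} → Path H L a b → Lifting e w L z → dest G w (labels H L) ≡ just z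
  Lifting-dest (single _) (stop _) = refl
  Lifting-dest {L = _ ∷ L} (cons ab p) (_ ∷⟨ f ⟩ l) with Follows⇒EdgeMatch ab f
  ... | wx , same-port , _ = begin
    dest G _ (port H _ _ ∷ labels H L)  ≡⟨ cong (λ p → dest G _ (p ∷ labels H L)) (sym same-port) ⟩
    dest G _ (port G _ _ ∷ labels H L)  ≡⟨ dest-port G (labels H L) wx ⟩
    dest G _ (labels H L)               ≡⟨ Lifting-dest p l ⟩
    just _                              ∎
    where open ≡-Reasoning

  module _ {k : ℕ} {v₀ : V G} {ṽ₀ : V H}
           (contractible : AllSimpleCyclesContractible k H) (v₀∼ṽ₀ : Sim (n H + k) G v₀ H ṽ₀) where

    closed-walk-lift′ : ∀ {L} → Acc (_<_ on length) L → Path H L ṽ₀ ṽ₀ → Lifting 0 v₀ L v₀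
    closed-walk-lift′ {L} (acc shorter) p with Unique⊎Repetition Data.Fin._≟_ L
    ... | inj₁ u with PathFT-unique-loop u p
    ...   | refl = stop (Sim-weaken z≤n v₀∼ṽ₀)
    closed-walk-lift′ (acc shorter) p | inj₂ (A , x , B , C , refl , u)
      with PathFT-split A p
    ... | to-x , from-x with PathFT-split (x ∷ B) from-x
    ... | cycle , rest with Lifting-split A (closed-walk-lift′ (shorter (length-cut-loop A x B C)) (PathFT-join A to-x rest))
    ... | y , l-to-x , l-rest with Path-lift {k} to-x (Sim-weaken prefix-short v₀∼ṽ₀)
      where
      prefix-short : length (A ++ [ x ]) + k ≤ n H + k
      prefix-short = +-monoˡ-≤ k (≤-trans (length-++-∷-≤ A x B) (Unique⇒length≤ u))
    ... | y′ , l′-to-x , x∼y′ with Lifting-end-unique to-x l′-to-x l-to-x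
    ... | refl = Lifting-join A l-to-x (Lifting-join (x ∷ B) (Contractible-lift (contractible _ simple) cycle x∼y′) l-rest)
      where
      simple : SimpleCycle H (x ∷ B ++ [ x ])
      simple = x , cycle , x ∷ B , refl , Unique-++⁻ʳ A u

    closed-walk-lift : ∀ {L} → Path H L ṽ₀ ṽ₀ → Lifting 0 v₀ L v₀
    closed-walk-lift {L} = closed-walk-lift′ (on-wellFounded length <-wellFounded L)

    walk-lift : ∀ {q ũ R} → Path H q ṽ₀ ũ → Path H (ũ ∷ R) ũ ṽ₀ →
                ∃[ z ] Lifting 0 v₀ q z × Lifting 0 z (ũ ∷ R) v₀
    walk-lift p back with PathFT-last p
    ... | vs , refl = Lifting-split vs (closed-walk-lift (PathFT-join vs p back))

    -- Close q and q′ by a common return path: both lifts end at v₀, and lifting backwards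
    -- along the return path is deterministic, so both pass through the same vertex above ũ.
    dest-path-independent : ∀ {ũ q q′} → Path H q ṽ₀ ũ → Path H q′ ṽ₀ ũ →
                            dest G v₀ (labels H q) ≡ dest G v₀ (labels H q′)
    dest-path-independent {ũ} p p′ with connected H ũ ṽ₀
    ... | _ ∷ R , back with PathFT-head back
    ... | refl with walk-lift p back | walk-lift p′ back
    ... | z , l , l-back | z′ , l′ , l′-back with Lifting-start-unique back l-back l′-back
    ... | refl = trans (Lifting-dest p l) (sym (Lifting-dest p′ l′))

proposition8 : (G : PGraph) (v₀ : V G) (k : ℕ) (H : PGraph) →
    HaltsWith G v₀ k H →
    (ṽ₀ : V H) → Sim (2 * k) G v₀ H ṽ₀ →
    (ũ : V H) (q q' : List (V H)) → Path H q ṽ₀ ũ → Path H q' ṽ₀ ũ →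
    dest G v₀ (labels H q) ≡ dest G v₀ (labels H q')
proposition8 G v₀ k H (_ , (|H|<k , _) , contractible , _) ṽ₀ v₀∼ṽ₀ ũ q q′ =
  dest-path-independent G H contractible (Sim-weaken |H|+k≤2k v₀∼ṽ₀)
  where
  |H|+k≤2k : n H + k ≤ 2 * k
  |H|+k≤2k = +-mono-≤ (<⇒≤ |H|<k) (m≤m+n k 0)
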